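{- Let $P$ be a set of $n$ points in a metric space $\mathcal{X}$, let $R,r\ge1$, $C\ge1$ and $\beta\in\mathbb{Z}_{\ge1}$. Let $G=(P,E)$ be a $C$-approximate $(R,r)$-near neighbor graph of $P$, let $P'=\{p\in P:|\Gamma_G(p)|\ge r\}$, let $S=\{s_1,\dots,s_t\}$ be a $\beta$-ruling set of $(G^2)[P']$, and let $P''=\{p\in P:\mathrm{dist}_G(p,S)\le2\beta\}$. Partition $P''$ into clusters $P_1,\dots,P_t$ with centers $c(P_i)=s_i$, where $s_i\in P_i$ and each $p\in P''\setminus S$ is added to an arbitrary cluster $P_i$ minimizing $\mathrm{dist}_G(p,c(P_i))$. Then for all $i\in[t]$, $|P_i|\ge r$ and $\mathrm{dist}(p,c(P_i))\le2\beta CR$ for all $p\in P_i$. Furthermore, for any $k\in[n]$, if $R\ge\widehat{\rho}^k(P)$, then $\sum_{i=1}^t|P_i|\ge n-k$.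
   Context: A graph $G=(V,E)$ is a $C$-approximate $(R,r)$-near neighbor graph of $P$ if $V=P$, every edge $(p,p')$ has $\mathrm{dist}_{\mathcal{X}}(p,p')\le CR$, and for every $p\in P$ either $|\Gamma_G(p)|\ge r$ or $\{p'\in P:\mathrm{dist}_{\mathcal{X}}(p,p')\le R\}\subseteq\Gamma_G(p)$. $\Gamma_G(v)$ is the set of neighbors of $v$ together with $v$; $\mathrm{dist}_G$ is shortest path distance, $\mathrm{dist}_G(p,S)=\min_{s\in S}\mathrm{dist}_G(p,s)$; $G^2$ joins $u,v$ iff $\mathrm{dist}_G(u,v)\le2$; $H[U]$ is the induced subgraph. A $\beta$-ruling set of a graph $H$ is an independent set $I$ of $H$ such that every vertex of $H$ is within distance $\beta$ of $I$ in $H$. $\rho_r(P,p)$ is the distance from $p$ to its $r$-th nearest neighbor in $P$ (the $1$st being $p$ itself); $\widehat{\rho}^k(P)=\min_{O\subseteq P,|O|\le k}\max_{p\in P\setminus O}\rho_r(P,p)$. -}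

module Defs where

open import Level using (0ℓ)
open import Data.Nat as ℕ using (ℕ; zero; suc)
open import Data.Fin using (Fin)
open import Data.Fin.Subset using (Subset; ⁅_⁆; _∪_; _∈_; _∉_; ∣_∣)
open import Data.List using (map)
open import Data.Nat.ListAction using (sum)
open import Data.List using (allFin)
open import Data.Product using (Σ; ∃; ∃-syntax; _×_; _,_)
open import Data.Sum using (_⊎_)
open import Relation.Binary.PropositionalEquality using (_≡_; _≢_)
open import Relation.Nullary using (¬_)

-- Distances,
-- R and C live in an abstract structure axiomatised by the properties
-- of the non-negative reals (ℝ≥0, +, *, ≤) that the statement uses.
-- Quantifying over all such structures is a generalisation of the
-- real-valued statement (ℝ≥0 is an instance).

record Scalars : Set₁ where
  infixl 6 _+_
  infixl 7 _*_
  infix  4 _≤_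
  field
    Carrier : Set
    0# 1#   : Carrier
    _+_ _*_ : Carrier → Carrier → Carrier
    _≤_     : Carrier → Carrier → Set
    ≤-refl  : ∀ {x} → x ≤ x
    ≤-trans : ∀ {x y z} → x ≤ y → y ≤ z → x ≤ z
    ≤-total : ∀ x y → x ≤ y ⊎ y ≤ x
    0≤      : ∀ x → 0# ≤ x
    +-mono-≤    : ∀ {a b c d} → a ≤ b → c ≤ d → a + c ≤ b + d
    +-identityˡ : ∀ x → 0# + x ≡ x
    +-identityʳ : ∀ x → x + 0# ≡ x
    +-comm      : ∀ x y → x + y ≡ y + x
    +-assoc     : ∀ x y z → (x + y) + z ≡ x + (y + z)
    *-identityˡ : ∀ x → 1# * x ≡ x
    *-comm      : ∀ x y → x * y ≡ y * x
    *-mono-≤    : ∀ {a b c d} → a ≤ b → c ≤ d → a * c ≤ b * d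

  infixr 7 _·ₙ_
  _·ₙ_ : ℕ → Carrier → Carrier
  zero  ·ₙ x = 0#
  suc m ·ₙ x = x + m ·ₙ x

record MetricSpace (K : Scalars) : Set₁ where
  open Scalars K
  field
    Point : Set
    dist  : Point → Point → Carrier
    dist-self  : ∀ x → dist x x ≡ 0#
    dist-zero  : ∀ x y → dist x y ≡ 0# → x ≡ y
    dist-sym   : ∀ x y → dist x y ≡ dist y x
    dist-tri   : ∀ x y z → dist x z ≤ dist x y + dist y z

-- Graphs on the vertex set Fin n (vertex i is the point pts i of P).
-- A graph is given by its neighbour sets; it is undirected.

Graph : ℕ → Set
Graph n = Fin n → Subset n

Undirected : ∀ {n} → Graph n → Set
Undirected {n} G = ∀ (u v : Fin n) → v ∈ G u → u ∈ G v

Adj : ∀ {n} → Graph n → Fin n → Fin n → Set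
Adj G u v = v ∈ G u

Γ : ∀ {n} → Graph n → Fin n → Subset n
Γ G v = ⁅ v ⁆ ∪ G v

-- WithinDist E L u v : there is a walk of length ≤ L from u to v using
-- the edge relation E, i.e. dist_E(u,v) ≤ L (shortest-path distance).
data WithinDist {n : ℕ} (E : Fin n → Fin n → Set) : ℕ → Fin n → Fin n → Set where
  here : ∀ {L u} → WithinDist E L u u
  step : ∀ {L u w v} → E u w → WithinDist E L w v → WithinDist E (suc L) u v

SquareInduced : ∀ {n} → Graph n → (Fin n → Set) → Fin n → Fin n → Set
SquareInduced G U u v = U u × U v × u ≢ v × WithinDist (Adj G) 2 u v

HighDegree : ∀ {n} → Graph n → ℕ → Fin n → Set
HighDegree G r p = r ℕ.≤ ∣ Γ G p ∣

-- S = {s_1,…,s_t} (s injective) is a β-ruling set of the graph H with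
-- vertex set U and edge relation E: S ⊆ U, S independent in H, and every
-- vertex of H is within H-distance β of S.
IsRulingSet : ∀ {n} (U : Fin n → Set) (E : Fin n → Fin n → Set) (β : ℕ)
              {t : ℕ} (s : Fin t → Fin n) → Set
IsRulingSet U E β {t} s =
    (∀ i → U (s i))
  × (∀ i j → ¬ E (s i) (s j))
  × (∀ v → U v → ∃[ i ] WithinDist E β v (s i))

module _ {K : Scalars} (X : MetricSpace K) where
  open Scalars K
  open MetricSpace X

  IsNearNeighborGraph : ∀ {n} (pts : Fin n → Point) (C R : Carrier) (r : ℕ)
                        → Graph n → Set
  IsNearNeighborGraph {n} pts C R r G =
      (∀ p q → Adj G p q → dist (pts p) (pts q) ≤ C * R)
    × (∀ p → r ℕ.≤ ∣ Γ G p ∣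
             ⊎ (∀ q → dist (pts p) (pts q) ≤ R → q ∈ Γ G p))

  -- ρ_r(P,p) ≤ R : the r-th nearest neighbour of p in P (p itself being
  -- the 1st) is at distance ≤ R, i.e. at least r points of P lie within
  -- distance R of p.  (When r > |P| there is no r-th neighbour and this
  -- never holds, i.e. ρ_r = ∞.)
  ρ≤ : ∀ {n} (pts : Fin n → Point) (r : ℕ) (p : Fin n) (R : Carrier) → Set
  ρ≤ {n} pts r p R = ∃[ B ] (r ℕ.≤ ∣ B ∣ × (∀ q → q ∈ B → dist (pts p) (pts q) ≤ R))

  -- ρ̂^k(P) ≤ R : min over O ⊆ P, |O| ≤ k, of max over p ∈ P∖O of
  -- ρ_r(P,p) is ≤ R.
  ρ̂≤ : ∀ {n} (pts : Fin n → Point) (r k : ℕ) (R : Carrier) → Set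
  ρ̂≤ {n} pts r k R =
    ∃[ O ] (∣ O ∣ ℕ.≤ k × (∀ p → p ∉ O → ρ≤ pts r p R))

Σ[_]_ : (t : ℕ) → (Fin t → ℕ) → ℕ
Σ[ t ] f = sum (map f (allFin t))

⟨_⟩ : Scalars → Set
⟨ K ⟩ = Scalars.Carrier K

1[_] : (K : Scalars) → ⟨ K ⟩
1[ K ] = Scalars.1# K

Le : (K : Scalars) → ⟨ K ⟩ → ⟨ K ⟩ → Set
Le K = Scalars._≤_ K

Mul : (K : Scalars) → ⟨ K ⟩ → ⟨ K ⟩ → ⟨ K ⟩
Mul K = Scalars._*_ K

NatMul : (K : Scalars) → ℕ → ⟨ K ⟩ → ⟨ K ⟩
NatMul K = Scalars._·ₙ_ K

Pt : {K : Scalars} → MetricSpace K → Set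
Pt X = MetricSpace.Point X

dist[_] : {K : Scalars} (X : MetricSpace K) → Pt X → Pt X → ⟨ K ⟩
dist[ X ] = MetricSpace.dist X

-- Every vertex q of Γ(sᵢ) lies in P'' and hence in some cluster Pⱼ; since the
-- cluster centre of a point is a G-nearest centre, q is adjacent (or equal) to
-- sⱼ, so sᵢ and sⱼ are within G-distance 2. Independence of S in G² forces
-- j = i, giving Γ(sᵢ) ⊆ Pᵢ and |Pᵢ| ≥ r. Each p ∈ Pᵢ reaches its nearest centre
-- sᵢ by a G-walk of length ≤ 2β whose edges have length ≤ CR. Finally, outside
-- the k outliers every point has r points within distance R, so it lies in P';
-- a G²-walk of length β to S becomes a G-walk of length 2β, so the clusters
-- cover all but at most k points.
module Submission where

open import Defs
open import Data.Nat using (ℕ; _≤_; _∸_; _*_; _+_; suc; z≤n; s≤s)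
open import Data.Nat.Properties
  using (≤-trans; ≤-reflexive; module ≤-Reasoning; +-suc; +-monoʳ-≤; m≤n+m; m≤m+n; *-comm; ∸-monoʳ-≤)
open import Data.Nat.ListAction using (sum)
open import Data.Fin using (Fin; _≟_)
open import Data.Fin.Properties using (any?)
open import Data.Fin.Subset
  using (Subset; _∈_; _∪_; ⁅_⁆; ⋃; ∁; _⊆_; inside; outside) renaming (∣_∣ to ∣_∣ₛ)
open import Data.Fin.Subset.Properties
  using (x∈p∪q⁻; x∈p∪q⁺; x∈⁅y⁆⇒x≡y; p⊆q⇒∣p∣≤∣q∣; ∣p∣≤∣x∷p∣; ∣⊥∣≡0; x∈∁p⇒x∉p; ∣∁p∣≡n∸∣p∣)
open import Data.Vec using ([]; _∷_)
open import Data.List using ([]; _∷_; map; allFin)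
open import Data.List.Relation.Unary.Any using (here; there)
open import Data.List.Membership.Propositional using () renaming (_∈_ to _∈ₗ_)
open import Data.List.Membership.Propositional.Properties using (∈-allFin)
open import Data.Product using (_×_; ∃-syntax; _,_)
open import Data.Sum using (_⊎_; inj₁; inj₂)
open import Data.Empty using (⊥-elim)
open import Relation.Nullary using (¬_; yes; no)
open import Relation.Binary.PropositionalEquality using (_≡_; _≢_; refl; sym; subst)
open import Function.Definitions using (Injective)

∣p∪q∣≤∣p∣+∣q∣ : ∀ {n} (p q : Subset n) → ∣ p ∪ q ∣ₛ ≤ ∣ p ∣ₛ + ∣ q ∣ₛ
∣p∪q∣≤∣p∣+∣q∣ []            []            = z≤n
∣p∪q∣≤∣p∣+∣q∣ (inside  ∷ p) (x ∷ q)       =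
  s≤s (≤-trans (∣p∪q∣≤∣p∣+∣q∣ p q) (+-monoʳ-≤ ∣ p ∣ₛ (∣p∣≤∣x∷p∣ x q)))
∣p∪q∣≤∣p∣+∣q∣ (outside ∷ p) (outside ∷ q) = ∣p∪q∣≤∣p∣+∣q∣ p q
∣p∪q∣≤∣p∣+∣q∣ (outside ∷ p) (inside  ∷ q) =
  ≤-trans (s≤s (∣p∪q∣≤∣p∣+∣q∣ p q)) (≤-reflexive (sym (+-suc ∣ p ∣ₛ ∣ q ∣ₛ)))

module _ {n} {A : Set} (Ps : A → Subset n) where

  ∣⋃∣≤sum : ∀ xs → ∣ ⋃ (map Ps xs) ∣ₛ ≤ sum (map (λ i → ∣ Ps i ∣ₛ) xs)
  ∣⋃∣≤sum []       = ≤-reflexive (∣⊥∣≡0 n)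
  ∣⋃∣≤sum (x ∷ xs) =
    ≤-trans (∣p∪q∣≤∣p∣+∣q∣ (Ps x) (⋃ (map Ps xs))) (+-monoʳ-≤ ∣ Ps x ∣ₛ (∣⋃∣≤sum xs))

  ∈⋃ : ∀ {xs i p} → i ∈ₗ xs → p ∈ Ps i → p ∈ ⋃ (map Ps xs)
  ∈⋃ (here refl) p∈ = x∈p∪q⁺ (inj₁ p∈)
  ∈⋃ (there i∈)  p∈ = x∈p∪q⁺ (inj₂ (∈⋃ i∈ p∈))

module _ {n} {E : Fin n → Fin n → Set} where

  WithinDist-weaken : ∀ {L L' u v} → L ≤ L' → WithinDist E L u v → WithinDist E L' u v
  WithinDist-weaken _          here       = here
  WithinDist-weaken (s≤s L≤L') (step e w) = step e (WithinDist-weaken L≤L' w)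

  WithinDist-++ : ∀ {a b u w v} → WithinDist E a u w → WithinDist E b w v → WithinDist E (a + b) u v
  WithinDist-++ {a} {b} here w' = WithinDist-weaken (m≤n+m b a) w'
  WithinDist-++ (step e w) w'   = step e (WithinDist-++ w w')

  WithinDist-subdivide : ∀ {E' : Fin n → Fin n → Set} {k} → (∀ {u v} → E' u v → WithinDist E k u v)
                       → ∀ {L u v} → WithinDist E' L u v → WithinDist E (L * k) u v
  WithinDist-subdivide edge here       = here
  WithinDist-subdivide edge (step e w) = WithinDist-++ (edge e) (WithinDist-subdivide edge w)

module _ {n} (G : Graph n) where

  ∈Γ⇒≡⊎Adj : ∀ {v q} → q ∈ Γ G v → q ≡ v ⊎ Adj G v q
  ∈Γ⇒≡⊎Adj {v} q∈ with x∈p∪q⁻ ⁅ v ⁆ (G v) q∈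
  ... | inj₁ q∈⁅v⁆ = inj₁ (x∈⁅y⁆⇒x≡y v q∈⁅v⁆)
  ... | inj₂ v~q   = inj₂ v~q

  ∈Γ⇒walk-from : ∀ {v q} → q ∈ Γ G v → WithinDist (Adj G) 1 v q
  ∈Γ⇒walk-from q∈ with ∈Γ⇒≡⊎Adj q∈
  ... | inj₁ refl = here
  ... | inj₂ v~q  = step v~q here

  ∈Γ⇒walk-to : Undirected G → ∀ {v q} → q ∈ Γ G v → WithinDist (Adj G) 1 q v
  ∈Γ⇒walk-to undirected q∈ with ∈Γ⇒≡⊎Adj q∈
  ... | inj₁ refl = here
  ... | inj₂ v~q  = step (undirected _ _ v~q) here

  module _ {U : Fin n → Set} {β t} {s : Fin t → Fin n}
           (ruling : IsRulingSet U (SquareInduced G U) β s) where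

    rulingSet-centres-far : Injective _≡_ _≡_ s
                          → ∀ {i j} → i ≢ j → ¬ WithinDist (Adj G) 2 (s i) (s j)
    rulingSet-centres-far s-inj {i} {j} i≢j w =
      let (s∈U , independent , _) = ruling
      in independent i j (s∈U i , s∈U j , (λ sᵢ≡sⱼ → i≢j (s-inj sᵢ≡sⱼ)) , w)

    rulingSet-reach : ∀ {v} → U v → ∃[ i ] WithinDist (Adj G) (2 * β) v (s i)
    rulingSet-reach {v} v∈U =
      let (_ , _ , dominating) = ruling
          (i , w) = dominating v v∈U
      in i , subst (λ L → WithinDist (Adj G) L v (s i)) (*-comm β 2)
                   (WithinDist-subdivide (λ (_ , _ , _ , w₂) → w₂) w)

module _ {K : Scalars} (X : MetricSpace K) where
  open Scalars K using (_·ₙ_; 0≤; +-mono-≤) renaming (_≤_ to _≤ₖ_; ≤-trans to ≤ₖ-trans)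
  open MetricSpace X

  dist-≤-walk : ∀ {n} {E : Fin n → Fin n → Set} (pts : Fin n → Point) {d}
              → (∀ {u v} → E u v → dist (pts u) (pts v) ≤ₖ d)
              → ∀ {L u v} → WithinDist E L u v → dist (pts u) (pts v) ≤ₖ L ·ₙ d
  dist-≤-walk pts {d} edge {L} {u} here =
    subst (_≤ₖ L ·ₙ d) (sym (dist-self (pts u))) (0≤ (L ·ₙ d))
  dist-≤-walk pts edge {u = u} {v} (step {w = w} e walk) =
    ≤ₖ-trans (dist-tri (pts u) (pts w) (pts v)) (+-mono-≤ (edge e) (dist-≤-walk pts edge walk))

  nearNeighbor-highDegree : ∀ {n} {pts : Fin n → Point} {C R r G}
                          → IsNearNeighborGraph X pts C R r G
                          → ∀ {p} → ρ≤ X pts r p R → HighDegree G r p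
  nearNeighbor-highDegree (_ , degree-or-ball) {p} (B , r≤∣B∣ , B-near) with degree-or-ball p
  ... | inj₁ r≤∣Γp∣ = r≤∣Γp∣
  ... | inj₂ ball⊆Γ = ≤-trans r≤∣B∣ (p⊆q⇒∣p∣≤∣q∣ (λ {q} q∈B → ball⊆Γ q (B-near q q∈B)))

module Clusters {n t} (G : Graph n) (s : Fin t → Fin n) (Ps : Fin t → Subset n)
  (disjoint   : ∀ i j p → p ∈ Ps i → p ∈ Ps j → i ≡ j)
  (centre∈    : ∀ i → s i ∈ Ps i)
  (nearest    : ∀ i p → p ∈ Ps i → (∀ j → p ≢ s j)
                → ∀ j L → WithinDist (Adj G) L p (s j) → WithinDist (Adj G) L p (s i))
  where

  centre-nearest : ∀ {i p} → p ∈ Ps i → ∀ {j L} → WithinDist (Adj G) L p (s j) → WithinDist (Adj G) L p (s i)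
  centre-nearest {i} {p} p∈ {j} {L} w with any? (λ k → p ≟ s k)
  ... | no  p∉S          = nearest i p p∈ (λ k p≡sₖ → p∉S (k , p≡sₖ)) j L w
  ... | yes (k , refl) with disjoint i k (s k) p∈ (centre∈ k)
  ...   | refl           = here

  Γ-centre⊆cluster : Undirected G
    → (∀ {i j} → i ≢ j → ¬ WithinDist (Adj G) 2 (s i) (s j))
    → ∀ {L} → 1 ≤ L → (∀ p → ∃[ j ] WithinDist (Adj G) L p (s j) → ∃[ i ] p ∈ Ps i)
    → ∀ i → Γ G (s i) ⊆ Ps i
  Γ-centre⊆cluster undirected far 1≤L covered i {q} q∈Γ
    with covered q (i , WithinDist-weaken 1≤L (∈Γ⇒walk-to G undirected q∈Γ))
  ... | (j , q∈Pⱼ) with j ≟ i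
  ...   | yes refl = q∈Pⱼ
  ...   | no  j≢i  = ⊥-elim (far (λ i≡j → j≢i (sym i≡j)) sᵢ⇝sⱼ)
    where
    sᵢ⇝sⱼ : WithinDist (Adj G) 2 (s i) (s j)
    sᵢ⇝sⱼ = WithinDist-++ (∈Γ⇒walk-from G q∈Γ) (centre-nearest q∈Pⱼ (∈Γ⇒walk-to G undirected q∈Γ))

mainTheorem12 : {K : Scalars} (X : MetricSpace K)
  → (n : ℕ) (pts : Fin n → Pt X) → Injective _≡_ _≡_ pts
  → (R C : ⟨ K ⟩) (r β : ℕ)
  → Le K 1[ K ] R → 1 ≤ r → Le K 1[ K ] C → 1 ≤ β
  → (G : Graph n) → Undirected G
  → IsNearNeighborGraph X pts C R r G
  → (t : ℕ) (s : Fin t → Fin n) → Injective _≡_ _≡_ s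
  → IsRulingSet (HighDegree G r) (SquareInduced G (HighDegree G r)) β s
  → (Ps : Fin t → Subset n)
  → (∀ i p → p ∈ Ps i → ∃[ j ] WithinDist (Adj G) (2 * β) p (s j))
  → (∀ p → (∃[ j ] WithinDist (Adj G) (2 * β) p (s j)) → ∃[ i ] p ∈ Ps i)
  → (∀ i j p → p ∈ Ps i → p ∈ Ps j → i ≡ j)
  → (∀ i → s i ∈ Ps i)
  → (∀ i p → p ∈ Ps i → (∀ j → p ≢ s j)
       → ∀ j L → WithinDist (Adj G) L p (s j) → WithinDist (Adj G) L p (s i))
  → (∀ i → r ≤ ∣ Ps i ∣ₛ
           × (∀ p → p ∈ Ps i
              → Le K (dist[ X ] (pts p) (pts (s i))) (NatMul K (2 * β) (Mul K C R))))
    × (∀ k → 1 ≤ k → k ≤ n → ρ̂≤ X pts r k R → n ∸ k ≤ Σ[ t ] (λ i → ∣ Ps i ∣ₛ))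
mainTheorem12 {K} X n pts _ R C r β _ _ _ 1≤β G undirected nng@(edge-short , _) t s s-inj
  ruling@(centres-high , _) Ps within-2β covered disjoint centre∈ nearest = cluster-bounds , clusters-cover
  where
  open Clusters G s Ps disjoint centre∈ nearest

  cluster-bounds : ∀ i → r ≤ ∣ Ps i ∣ₛ
    × (∀ p → p ∈ Ps i → Le K (dist[ X ] (pts p) (pts (s i))) (NatMul K (2 * β) (Mul K C R)))
  cluster-bounds i =
      ≤-trans (centres-high i) (p⊆q⇒∣p∣≤∣q∣ (Γ-centre⊆cluster undirected
        (rulingSet-centres-far G ruling s-inj) (≤-trans 1≤β (m≤m+n β _)) covered i))
    , λ p p∈ → let (j , w) = within-2β i p p∈
               in dist-≤-walk X pts (edge-short _ _) (centre-nearest p∈ w)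

  clusters-cover : ∀ k → 1 ≤ k → k ≤ n → ρ̂≤ X pts r k R → n ∸ k ≤ Σ[ t ] (λ i → ∣ Ps i ∣ₛ)
  clusters-cover k _ _ (O , ∣O∣≤k , dense) = begin
    n ∸ k                       ≤⟨ ∸-monoʳ-≤ n ∣O∣≤k ⟩
    n ∸ ∣ O ∣ₛ                  ≡⟨ sym (∣∁p∣≡n∸∣p∣ O) ⟩
    ∣ ∁ O ∣ₛ                    ≤⟨ p⊆q⇒∣p∣≤∣q∣ inliers⊆⋃ ⟩
    ∣ ⋃ (map Ps (allFin t)) ∣ₛ  ≤⟨ ∣⋃∣≤sum Ps (allFin t) ⟩
    Σ[ t ] (λ i → ∣ Ps i ∣ₛ)    ∎
    where
    open ≤-Reasoning
    inliers⊆⋃ : ∁ O ⊆ ⋃ (map Ps (allFin t))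
    inliers⊆⋃ {p} p∈∁O =
      let (i , p∈Pᵢ) = covered p (rulingSet-reach G ruling
                         (nearNeighbor-highDegree X nng (dense p (x∈∁p⇒x∉p p∈∁O))))
      in ∈⋃ Ps (∈-allFin i) p∈Pᵢ
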